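{- Let $b\ge 3$. Then there exists a connected graph $G$ such that $rc^\ell(G)=2$ and $src^\ell(G)=b$.
   Context: An edge-coloured path is rainbow if all its edges have distinct colours; a geodesic is a shortest path between its endpoints. An (not necessarily proper) edge-colouring of a connected graph is rainbow connected (resp. strongly rainbow connected) if any two vertices are joined by a rainbow path (resp. rainbow geodesic). An $r$-edge-list assignment of $G$ assigns to each edge $e$ a set $L(e)\subset\mathbb N$ with $|L(e)|\ge r$; an $L$-edge-colouring is an edge-colouring $c$ with $c(e)\in L(e)$ for all $e$. $rc^\ell(G)$ (resp. $src^\ell(G)$) is the minimum integer $r$ such that for every $r$-edge-list assignment $L$ of $G$ there exists a rainbow connected (resp. strongly rainbow connected) $L$-edge-colouring of $G$. -}

module Defs where

open import Data.Nat using (ℕ; zero; suc; _<_)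
open import Data.Fin using (Fin; zero; suc; fromℕ; inject₁)
open import Data.Product using (Σ; _×_; _,_; ∃)
open import Relation.Binary.PropositionalEquality using (_≡_)
open import Relation.Nullary using (¬_)
open import Function.Definitions using (Injective)

record Graph : Set₁ where
  field
    n      : ℕ
    Adj    : Fin n → Fin n → Set
    sym    : ∀ {u v} → Adj u v → Adj v u
    irrefl : ∀ {u} → ¬ Adj u u

module _ (G : Graph) where
  open Graph G

  record Path (u v : Fin n) (k : ℕ) : Set where
    field
      vtx   : Fin (suc k) → Fin n
      start : vtx zero ≡ u
      end   : vtx (fromℕ k) ≡ v
      inj   : Injective _≡_ _≡_ vtx
      adj   : ∀ (i : Fin k) → Adj (vtx (inject₁ i)) (vtx (suc i))

  Connected : Set
  Connected = ∀ u v → ∃ λ k → Path u v k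

  record Colouring : Set where
    field
      col    : Fin n → Fin n → ℕ
      colSym : ∀ {u v} → Adj u v → col u v ≡ col v u

  open Colouring public

  edgeCol : ∀ {u v k} → Colouring → Path u v k → Fin k → ℕ
  edgeCol c p i = col c (Path.vtx p (inject₁ i)) (Path.vtx p (suc i))

  Rainbow : ∀ {u v k} → Colouring → Path u v k → Set
  Rainbow c p = Injective _≡_ _≡_ (edgeCol c p)

  Geodesic : ∀ {u v k} → Path u v k → Set
  Geodesic {u} {v} {k} p = ∀ m → m < k → ¬ Path u v m

  RainbowConnected : Colouring → Set
  RainbowConnected c = ∀ u v → Σ ℕ λ k → Σ (Path u v k) λ p → Rainbow c p

  StronglyRainbowConnected : Colouring → Set
  StronglyRainbowConnected c =
    ∀ u v → Σ ℕ λ k → Σ (Path u v k) λ p → Geodesic p × Rainbow c p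

  record ListAssignment : Set₁ where
    field
      L    : Fin n → Fin n → ℕ → Set
      LSym : ∀ {u v x} → Adj u v → L u v x → L v u x

  open ListAssignment public

  AtLeast : ℕ → (ℕ → Set) → Set
  AtLeast r S = Σ (Fin r → ℕ) λ f → Injective _≡_ _≡_ f × (∀ i → S (f i))

  IsRList : ℕ → ListAssignment → Set
  IsRList r La = ∀ u v → Adj u v → AtLeast r (L La u v)

  IsLColouring : ListAssignment → Colouring → Set
  IsLColouring La c = ∀ u v → Adj u v → L La u v (col c u v)

  RCList : ℕ → Set₁
  RCList r = ∀ La → IsRList r La →
             Σ Colouring λ c → IsLColouring La c × RainbowConnected c

  SRCList : ℕ → Set₁
  SRCList r = ∀ La → IsRList r La →
              Σ Colouring λ c → IsLColouring La c × StronglyRainbowConnected c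

IsMin : (ℕ → Set₁) → ℕ → Set₁
IsMin P r = P r × (∀ s → s < r → ¬ P s)

rcℓ≡ : Graph → ℕ → Set₁
rcℓ≡ G r = IsMin (RCList G) r

srcℓ≡ : Graph → ℕ → Set₁
srcℓ≡ G r = IsMin (SRCList G) r

-- The graph is a hub joined to two disjoint cliques A ≅ K_p and B ≅ K_q, with p = b − 1 and q = p^p.
-- Only the pairs (Aᵢ, Bⱼ) are nonadjacent, and their geodesics all run Aᵢ – hub – Bⱼ, so a colouring
-- is strongly rainbow connected iff the spokes hub–Aᵢ and hub–Bⱼ always differ in colour.
-- With (p+1)-lists every B-spoke can avoid the p colours of the A-spokes. With p-lists it cannot:
-- index B by the functions g : Fin p → Fin p, give hub–Aᵢ the list {(i, t)} and hub–B_g the list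
-- {(i, g i)}; the colours chosen on the A-spokes determine some g, and the spoke at B_g repeats one.
-- For rainbow connection 2-lists suffice, since a detour through a fixed A₀ repairs equal spokes,
-- whereas constant lists leave no rainbow path from A to B.
module Submission where

open import Defs
open import Data.Nat using (ℕ; zero; suc; _+_; _^_; _≤_; z≤n; s≤s)
import Data.Nat as ℕ
import Data.Nat.Properties as ℕ
open import Data.Fin using (Fin; zero; suc; fromℕ; inject₁; opposite; toℕ; _↑ˡ_; _↑ʳ_; splitAt; join; combine; funToFin; finToFun; inject≤)
open import Data.Fin.Properties
  using (_≟_; _<?_; <⇒≢; <-asym; ≤-antisym; toℕ-injective; inject≤-injective; opposite-involutive;
         splitAt-↑ˡ; splitAt-↑ʳ; join-splitAt; combine-injectiveˡ; combine-injectiveʳ; finToFun-funToFin;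
         all?; any?; ¬∀⟶∃¬; injective⇒≤)
open import Data.Product using (Σ; _×_; _,_; proj₁; proj₂)
open import Data.Sum using (inj₁; inj₂; [_,_]′)
open import Data.Empty using (⊥; ⊥-elim)
open import Data.Unit using (⊤; tt)
open import Function using (_∘_)
open import Function.Definitions using (Injective)
open import Relation.Binary.PropositionalEquality
open import Relation.Nullary using (¬_; Dec; yes; no)

opposite-fromℕ : ∀ k → opposite (fromℕ k) ≡ zero
opposite-fromℕ zero    = refl
opposite-fromℕ (suc k) = cong inject₁ (opposite-fromℕ k)

opposite-inject₁ : ∀ {k} (i : Fin k) → opposite (inject₁ i) ≡ suc (opposite i)
opposite-inject₁ zero    = refl
opposite-inject₁ (suc i) = cong inject₁ (opposite-inject₁ i)

opposite-injective : ∀ {k} → Injective _≡_ _≡_ (opposite {k})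
opposite-injective {x = i} {y = j} e =
  trans (sym (opposite-involutive i)) (trans (cong opposite e) (opposite-involutive j))

module _ {G : Graph} where
  open Graph G using (n; Adj; irrefl) renaming (sym to Adj-sym)
  open Path

  adj⇒≢ : ∀ {u v} → Adj u v → u ≢ v
  adj⇒≢ a refl = irrefl a

  trivial : ∀ u → Path G u u 0
  trivial u = record
    { vtx = λ _ → u ; start = refl ; end = refl
    ; inj = λ { {zero} {zero} _ → refl } ; adj = λ () }

  extend : ∀ {u w v k} → Adj u w → (p : Path G w v k) → (∀ i → u ≢ vtx p i) →
           Path G u v (suc k)
  extend {u} {k = k} a p fresh = record
    { vtx = vtx′ ; start = refl ; end = end p ; inj = inj′ ; adj = adj′ }
    where
    vtx′ : Fin (suc (suc k)) → Fin n
    vtx′ zero    = u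
    vtx′ (suc i) = vtx p i
    inj′ : Injective _≡_ _≡_ vtx′
    inj′ {zero}  {zero}  _ = refl
    inj′ {zero}  {suc j} e = ⊥-elim (fresh j e)
    inj′ {suc i} {zero}  e = ⊥-elim (fresh i (sym e))
    inj′ {suc i} {suc j} e = cong suc (inj p e)
    adj′ : ∀ i → Adj (vtx′ (inject₁ i)) (vtx′ (suc i))
    adj′ zero    = subst (Adj u) (sym (start p)) a
    adj′ (suc i) = adj p i

  edge : ∀ {u v} → Adj u v → Path G u v 1
  edge a = extend a (trivial _) λ { zero → adj⇒≢ a }

  path₂ : ∀ {u w v} → Adj u w → Adj w v → u ≢ v → Path G u v 2
  path₂ a b u≢v = extend a (edge b) λ { zero → adj⇒≢ a ; (suc zero) → u≢v }

  reverse : ∀ {u v k} → Path G u v k → Path G v u k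
  reverse {k = k} p = record
    { vtx = vtx p ∘ opposite
    ; start = end p
    ; end = trans (cong (vtx p) (opposite-fromℕ k)) (start p)
    ; inj = opposite-injective ∘ inj p
    ; adj = λ i → subst (λ x → Adj (vtx p x) (vtx p (inject₁ (opposite i))))
                        (sym (opposite-inject₁ i)) (Adj-sym (adj p (opposite i)))
    }

  path₀⇒≡ : ∀ {u v} → Path G u v 0 → u ≡ v
  path₀⇒≡ p = trans (sym (start p)) (end p)

  path₁⇒adj : ∀ {u v} → Path G u v 1 → Adj u v
  path₁⇒adj p = subst₂ Adj (start p) (end p) (adj p zero)

  middle-adj : ∀ {u v} (p : Path G u v 2) → Adj u (vtx p (suc zero)) × Adj (vtx p (suc zero)) v
  middle-adj p = subst (λ x → Adj x _) (start p) (adj p zero) , subst (Adj _) (end p) (adj p (suc zero))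

  trivial-geodesic : ∀ u → Geodesic G (trivial u)
  trivial-geodesic u _ ()

  edge-geodesic : ∀ {u v} (a : Adj u v) → Geodesic G (edge a)
  edge-geodesic a zero _ q = adj⇒≢ a (path₀⇒≡ q)
  edge-geodesic a (suc m) (s≤s ())

  path₂-geodesic : ∀ {u w v} (a : Adj u w) (b : Adj w v) (u≢v : u ≢ v) → ¬ Adj u v →
                   Geodesic G (path₂ a b u≢v)
  path₂-geodesic a b u≢v ¬a zero          _ q = u≢v (path₀⇒≡ q)
  path₂-geodesic a b u≢v ¬a (suc zero)    _ q = ¬a (path₁⇒adj q)
  path₂-geodesic a b u≢v ¬a (suc (suc m)) (s≤s (s≤s ()))

  reverse-geodesic : ∀ {u v k} (p : Path G u v k) → Geodesic G p → Geodesic G (reverse p)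
  reverse-geodesic p geo m m<k q = geo m m<k (reverse q)

  module _ (c : Colouring G) where

    trivial-rainbow : ∀ u → Rainbow G c (trivial u)
    trivial-rainbow u {()}

    extend-rainbow : ∀ {u w v k} (a : Adj u w) (p : Path G w v k) (fresh : ∀ i → u ≢ vtx p i) →
                     Rainbow G c p → (∀ i → col c u w ≢ edgeCol G c p i) →
                     Rainbow G c (extend a p fresh)
    extend-rainbow a p fresh rb new {zero}  {zero}  _ = refl
    extend-rainbow {u} a p fresh rb new {zero}  {suc j} e =
      ⊥-elim (new j (trans (cong (col c u) (sym (start p))) e))
    extend-rainbow {u} a p fresh rb new {suc i} {zero}  e =
      ⊥-elim (new i (trans (cong (col c u) (sym (start p))) (sym e)))
    extend-rainbow a p fresh rb new {suc i} {suc j} e = cong suc (rb e)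

    length₁-rainbow : ∀ {u v} (p : Path G u v 1) → Rainbow G c p
    length₁-rainbow p {zero} {zero} _ = refl

    length₂-rainbow : ∀ {u v} (p : Path G u v 2) →
                      edgeCol G c p zero ≢ edgeCol G c p (suc zero) → Rainbow G c p
    length₂-rainbow p d {zero}     {zero}     _ = refl
    length₂-rainbow p d {zero}     {suc zero} e = ⊥-elim (d e)
    length₂-rainbow p d {suc zero} {zero}     e = ⊥-elim (d (sym e))
    length₂-rainbow p d {suc zero} {suc zero} _ = refl

    reverse-edgeCol : ∀ {u v k} (p : Path G u v k) i →
                      edgeCol G c (reverse p) i ≡ edgeCol G c p (opposite i)
    reverse-edgeCol p i = begin
      col c (vtx p (opposite (inject₁ i))) (vtx p (inject₁ (opposite i)))
        ≡⟨ cong (λ x → col c (vtx p x) (vtx p (inject₁ (opposite i)))) (opposite-inject₁ i) ⟩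
      col c (vtx p (suc (opposite i))) (vtx p (inject₁ (opposite i)))
        ≡⟨ colSym c (Adj-sym (adj p (opposite i))) ⟩
      col c (vtx p (inject₁ (opposite i))) (vtx p (suc (opposite i)))
        ∎
      where open ≡-Reasoning

    reverse-rainbow : ∀ {u v k} (p : Path G u v k) → Rainbow G c p → Rainbow G c (reverse p)
    reverse-rainbow p rb {i} {j} e =
      opposite-injective (rb (trans (sym (reverse-edgeCol p i)) (trans e (reverse-edgeCol p j))))

    middle-colours-differ : ∀ {u v} (p : Path G u v 2) → Rainbow G c p →
                            col c u (vtx p (suc zero)) ≢ col c (vtx p (suc zero)) v
    middle-colours-differ p rb e with () ← rb {zero} {suc zero}
      (trans (cong (λ x → col c x _) (start p)) (trans e (cong (col c _) (sym (end p)))))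

    monochromatic-rainbow-≤1 : ∀ {z u v k} → (∀ {x y} → Adj x y → col c x y ≡ z) →
                               (p : Path G u v k) → Rainbow G c p → k ≤ 1
    monochromatic-rainbow-≤1 {k = zero}        mono p rb = z≤n
    monochromatic-rainbow-≤1 {k = suc zero}    mono p rb = s≤s z≤n
    monochromatic-rainbow-≤1 {k = suc (suc k)} mono p rb
      with () ← rb {zero} {suc zero} (trans (mono (adj p zero)) (sym (mono (adj p (suc zero)))))

module _ {G : Graph} where

  RainbowPath : Colouring G → Fin (Graph.n G) → Fin (Graph.n G) → Set
  RainbowPath c u v = Σ ℕ λ k → Σ (Path G u v k) (Rainbow G c)

  RainbowGeodesic : Colouring G → Fin (Graph.n G) → Fin (Graph.n G) → Set
  RainbowGeodesic c u v = Σ ℕ λ k → Σ (Path G u v k) λ p → Geodesic G p × Rainbow G c p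

  rainbowGeodesic⇒rainbowPath : ∀ {c u v} → RainbowGeodesic c u v → RainbowPath c u v
  rainbowGeodesic⇒rainbowPath (k , p , _ , rb) = k , p , rb

  first : ∀ {r S} → AtLeast G (suc r) S → Σ ℕ S
  first (f , _ , f∈) = f zero , f∈ zero

  avoid : ∀ {r S} → AtLeast G (suc r) S → (a : Fin r → ℕ) → Σ ℕ λ y → S y × (∀ i → y ≢ a i)
  avoid {r} (f , f-inj , f∈) a with all? (λ t → any? (λ i → f t ℕ.≟ a i))
  ... | yes hit = ⊥-elim (ℕ.1+n≰n (injective⇒≤ φ-inj))
    where
    φ : Fin (suc r) → Fin r
    φ t = proj₁ (hit t)
    φ-inj : Injective _≡_ _≡_ φ
    φ-inj {t} {t′} e = f-inj (trans (proj₂ (hit t)) (trans (cong a e) (sym (proj₂ (hit t′)))))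
  ... | no ¬hit with ¬∀⟶∃¬ (suc r) _ (λ t → any? (λ i → f t ℕ.≟ a i)) ¬hit
  ...   | t , miss = f t , f∈ t , λ i e → miss (i , e)

  AtLeast-≤ : ∀ {s r S} → s ≤ r → AtLeast G r S → AtLeast G s S
  AtLeast-≤ s≤r (f , f-inj , f∈) =
    f ∘ (λ i → inject≤ i s≤r) , inject≤-injective s≤r s≤r _ _ ∘ f-inj , λ i → f∈ _

  RCList-mono : ∀ {s r} → s ≤ r → RCList G s → RCList G r
  RCList-mono s≤r rc La lists = rc La (λ u v a → AtLeast-≤ {S = L La u v} s≤r (lists u v a))

  SRCList-mono : ∀ {s r} → s ≤ r → SRCList G s → SRCList G r
  SRCList-mono s≤r src La lists = src La (λ u v a → AtLeast-≤ {S = L La u v} s≤r (lists u v a))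

  RCList⇒Connected : ∀ {r} → RCList G r → Connected G
  RCList⇒Connected rc u v =
    let (_ , _ , connects) = rc allColours (λ _ _ _ → toℕ , toℕ-injective , _)
        (k , p , _)        = connects u v
    in k , p
    where
    allColours : ListAssignment G
    allColours = record { L = λ _ _ _ → ⊤ ; LSym = λ _ _ → tt }

monotone-isMin : ∀ {P : ℕ → Set₁} {r} → (∀ {s t} → s ≤ t → P s → P t) → P (suc r) → ¬ P r →
                 IsMin P (suc r)
monotone-isMin mono Pr+1 ¬Pr = Pr+1 , λ s s<r+1 Ps → ¬Pr (mono (ℕ.≤-pred s<r+1) Ps)

record SymmetricChoice {K : ℕ} (S : Fin K → Fin K → ℕ → Set) : Set where
  field
    choice     : Fin K → Fin K → ℕ
    choice-sym : ∀ i k → choice i k ≡ choice k i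
    choice-∈   : ∀ {i k} → i ≢ k → S i k (choice i k)

open SymmetricChoice

symmetricChoice : ∀ {K} {S : Fin K → Fin K → ℕ → Set} →
                  (∀ {i k y} → i ≢ k → S i k y → S k i y) → (∀ {i k} → i ≢ k → Σ ℕ (S i k)) →
                  SymmetricChoice S
symmetricChoice {K} {S} S-sym pick = record { choice = κ ; choice-sym = κ-sym ; choice-∈ = κ-∈ }
  where
  κ : Fin K → Fin K → ℕ
  κ i k with i <? k | k <? i
  ... | yes i<k | _       = proj₁ (pick (<⇒≢ i<k))
  ... | no _    | yes k<i = proj₁ (pick (<⇒≢ k<i))
  ... | no _    | no _    = 0
  κ-sym : ∀ i k → κ i k ≡ κ k i
  κ-sym i k with i <? k | k <? i
  ... | yes i<k | yes k<i = ⊥-elim (<-asym i<k k<i)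
  ... | yes _   | no _    = refl
  ... | no _    | yes _   = refl
  ... | no _    | no _    = refl
  κ-∈ : ∀ {i k} → i ≢ k → S i k (κ i k)
  κ-∈ {i} {k} i≢k with i <? k | k <? i
  ... | yes i<k | _       = proj₂ (pick (<⇒≢ i<k))
  ... | no _    | yes k<i = S-sym (<⇒≢ k<i) (proj₂ (pick (<⇒≢ k<i)))
  ... | no i≮k  | no k≮i  = ⊥-elim (i≢k (≤-antisym (ℕ.≮⇒≥ k≮i) (ℕ.≮⇒≥ i≮k)))

SymmetricChoice-map : ∀ {K} {S S′ : Fin K → Fin K → ℕ → Set} → (∀ {i k y} → S i k y → S′ i k y) →
                      SymmetricChoice S → SymmetricChoice S′
SymmetricChoice-map S⊆S′ κ = record
  { choice = choice κ ; choice-sym = choice-sym κ ; choice-∈ = S⊆S′ ∘ choice-∈ κ }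

module HubAndCliques (p q : ℕ) where

  data Vertex : Set where
    hub : Vertex
    A   : Fin p → Vertex
    B   : Fin q → Vertex

  enc : Vertex → Fin (suc (p + q))
  enc hub   = zero
  enc (A i) = suc (i ↑ˡ q)
  enc (B j) = suc (p ↑ʳ j)

  dec : Fin (suc (p + q)) → Vertex
  dec zero    = hub
  dec (suc k) = [ A , B ]′ (splitAt p k)

  dec-enc : ∀ X → dec (enc X) ≡ X
  dec-enc hub   = refl
  dec-enc (A i) = cong [ A , B ]′ (splitAt-↑ˡ p i q)
  dec-enc (B j) = cong [ A , B ]′ (splitAt-↑ʳ p q j)

  enc-dec : ∀ u → enc (dec u) ≡ u
  enc-dec zero    = refl
  enc-dec (suc k) = trans (enc-[A,B] (splitAt p k)) (cong suc (join-splitAt p q k))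
    where
    enc-[A,B] : ∀ s → enc ([ A , B ]′ s) ≡ suc (join p q s)
    enc-[A,B] (inj₁ i) = refl
    enc-[A,B] (inj₂ j) = refl

  enc-injective : ∀ {X Y} → enc X ≡ enc Y → X ≡ Y
  enc-injective {X} {Y} e = trans (sym (dec-enc X)) (trans (cong dec e) (dec-enc Y))

  Adjᵛ : Vertex → Vertex → Set
  Adjᵛ hub   (A _) = ⊤
  Adjᵛ hub   (B _) = ⊤
  Adjᵛ (A _) hub   = ⊤
  Adjᵛ (B _) hub   = ⊤
  Adjᵛ (A i) (A k) = i ≢ k
  Adjᵛ (B j) (B l) = j ≢ l
  Adjᵛ _     _     = ⊥

  Adjᵛ-sym : ∀ X Y → Adjᵛ X Y → Adjᵛ Y X
  Adjᵛ-sym hub   (A _) _   = tt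
  Adjᵛ-sym hub   (B _) _   = tt
  Adjᵛ-sym (A _) hub   _   = tt
  Adjᵛ-sym (B _) hub   _   = tt
  Adjᵛ-sym (A i) (A k) i≢k = i≢k ∘ sym
  Adjᵛ-sym (B j) (B l) j≢l = j≢l ∘ sym

  Adjᵛ-irrefl : ∀ X → ¬ Adjᵛ X X
  Adjᵛ-irrefl (A i) i≢i = i≢i refl
  Adjᵛ-irrefl (B j) j≢j = j≢j refl

  G : Graph
  G = record
    { n      = suc (p + q)
    ; Adj    = λ u v → Adjᵛ (dec u) (dec v)
    ; sym    = λ {u} {v} → Adjᵛ-sym (dec u) (dec v)
    ; irrefl = λ {u} → Adjᵛ-irrefl (dec u)
    }

  open Graph G using (Adj)

  enc-adj : ∀ {X Y} → Adjᵛ X Y → Adj (enc X) (enc Y)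
  enc-adj {X} {Y} = subst₂ Adjᵛ (sym (dec-enc X)) (sym (dec-enc Y))

  across-≢ : ∀ {i j} → enc (A i) ≢ enc (B j)
  across-≢ {i} {j} e with () ← enc-injective {A i} {B j} e

  across-¬adj : ∀ {i j} → ¬ Adj (enc (A i)) (enc (B j))
  across-¬adj {i} {j} a with () ← subst₂ Adjᵛ (dec-enc (A i)) (dec-enc (B j)) a

  across-length : ∀ {i j k} → Path G (enc (A i)) (enc (B j)) k → 2 ≤ k
  across-length {k = zero}        p = ⊥-elim (across-≢ (path₀⇒≡ p))
  across-length {k = suc zero}    p = ⊥-elim (across-¬adj (path₁⇒adj p))
  across-length {k = suc (suc _)} p = s≤s (s≤s z≤n)

  across-via-hub : ∀ i j → Path G (enc (A i)) (enc (B j)) 2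
  across-via-hub i j = path₂ {w = enc hub} (enc-adj {A i} {hub} tt) (enc-adj {hub} {B j} tt) across-≢

  across-via-hub-geodesic : ∀ i j → Geodesic G (across-via-hub i j)
  across-via-hub-geodesic i j =
    path₂-geodesic {w = enc hub} (enc-adj {A i} {hub} tt) (enc-adj {hub} {B j} tt) across-≢ across-¬adj

  across-common-neighbour : ∀ {i j w} → Adj (enc (A i)) w → Adj w (enc (B j)) → w ≡ enc hub
  across-common-neighbour {i} {j} {w} a b =
    trans (sym (enc-dec w))
          (cong enc (only-hub (dec w) (subst (λ X → Adjᵛ X (dec w)) (dec-enc (A i)) a)
                                      (subst (Adjᵛ (dec w)) (dec-enc (B j)) b)))
    where
    only-hub : ∀ W → Adjᵛ (A i) W → Adjᵛ W (B j) → W ≡ hub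
    only-hub hub _ _ = refl

  data Pair : Fin (suc (p + q)) → Fin (suc (p + q)) → Set where
    equal    : ∀ {u} → Pair u u
    adjacent : ∀ {u v} → Adj u v → Pair u v
    across   : ∀ i j → Pair (enc (A i)) (enc (B j))
    across˘  : ∀ i j → Pair (enc (B j)) (enc (A i))

  pair : ∀ u v → Pair u v
  pair u v = subst₂ Pair (enc-dec u) (enc-dec v) (pairᵛ (dec u) (dec v))
    where
    pairᵛ : ∀ X Y → Pair (enc X) (enc Y)
    pairᵛ hub   hub   = equal
    pairᵛ hub   (A i) = adjacent (enc-adj {hub} {A i} tt)
    pairᵛ hub   (B j) = adjacent (enc-adj {hub} {B j} tt)
    pairᵛ (A i) hub   = adjacent (enc-adj {A i} {hub} tt)
    pairᵛ (B j) hub   = adjacent (enc-adj {B j} {hub} tt)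
    pairᵛ (A i) (B j) = across i j
    pairᵛ (B j) (A i) = across˘ i j
    pairᵛ (A i) (A k) with i ≟ k
    ... | yes refl = equal
    ... | no i≢k   = adjacent (enc-adj {A i} {A k} i≢k)
    pairᵛ (B j) (B l) with j ≟ l
    ... | yes refl = equal
    ... | no j≢l   = adjacent (enc-adj {B j} {B l} j≢l)

  module _ (c : Colouring G) where

    rainbowConnected : (∀ i j → RainbowPath c (enc (A i)) (enc (B j))) → RainbowConnected G c
    rainbowConnected connect u v with pair u v
    ... | equal       = 0 , trivial u , trivial-rainbow c u
    ... | adjacent a  = 1 , edge a , length₁-rainbow c (edge a)
    ... | across i j  = connect i j
    ... | across˘ i j with connect i j
    ...   | k , p , rb = k , reverse p , reverse-rainbow c p rb

    stronglyRainbowConnected : (∀ i j → RainbowGeodesic c (enc (A i)) (enc (B j))) →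
                               StronglyRainbowConnected G c
    stronglyRainbowConnected connect u v with pair u v
    ... | equal       = 0 , trivial u , trivial-geodesic u , trivial-rainbow c u
    ... | adjacent a  = 1 , edge a , edge-geodesic a , length₁-rainbow c (edge a)
    ... | across i j  = connect i j
    ... | across˘ i j with connect i j
    ...   | k , p , geo , rb = k , reverse p , reverse-geodesic p geo , reverse-rainbow c p rb

    rainbowGeodesic⇒spokes-differ : ∀ {i j} → RainbowGeodesic c (enc (A i)) (enc (B j)) →
                                    col c (enc hub) (enc (A i)) ≢ col c (enc hub) (enc (B j))
    rainbowGeodesic⇒spokes-differ (zero , p , _) = ⊥-elim (across-≢ (path₀⇒≡ p))
    rainbowGeodesic⇒spokes-differ (suc zero , p , _) = ⊥-elim (across-¬adj (path₁⇒adj p))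
    rainbowGeodesic⇒spokes-differ {i} {j} (suc (suc (suc _)) , _ , geo , _) =
      ⊥-elim (geo 2 (s≤s (s≤s (s≤s z≤n))) (across-via-hub i j))
    rainbowGeodesic⇒spokes-differ {i} {j} (suc (suc zero) , p , _ , rb) e =
      middle-colours-differ c p rb (subst (λ w → col c (enc (A i)) w ≡ col c w (enc (B j)))
                                          (sym w≡hub) (trans (colSym c (enc-adj {A i} {hub} tt)) e))
      where
      w≡hub : Path.vtx p (suc zero) ≡ enc hub
      w≡hub = across-common-neighbour (proj₁ (middle-adj p)) (proj₂ (middle-adj p))

  module SpokeColouring (La : ListAssignment G)
    (spokeA : Fin p → ℕ) (spokeA-∈ : ∀ i → L La (enc hub) (enc (A i)) (spokeA i))
    (spokeB : Fin q → ℕ) (spokeB-∈ : ∀ j → L La (enc hub) (enc (B j)) (spokeB j))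
    (cliqueA : SymmetricChoice λ i k → L La (enc (A i)) (enc (A k)))
    (cliqueB : SymmetricChoice λ j l → L La (enc (B j)) (enc (B l)))
    where

    colᵛ : Vertex → Vertex → ℕ
    colᵛ hub   (A i) = spokeA i
    colᵛ (A i) hub   = spokeA i
    colᵛ hub   (B j) = spokeB j
    colᵛ (B j) hub   = spokeB j
    colᵛ (A i) (A k) = choice cliqueA i k
    colᵛ (B j) (B l) = choice cliqueB j l
    colᵛ _     _     = 0

    colᵛ-sym : ∀ X Y → colᵛ X Y ≡ colᵛ Y X
    colᵛ-sym hub   hub   = refl
    colᵛ-sym hub   (A _) = refl
    colᵛ-sym hub   (B _) = refl
    colᵛ-sym (A _) hub   = refl
    colᵛ-sym (B _) hub   = refl
    colᵛ-sym (A i) (A k) = choice-sym cliqueA i k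
    colᵛ-sym (B j) (B l) = choice-sym cliqueB j l
    colᵛ-sym (A _) (B _) = refl
    colᵛ-sym (B _) (A _) = refl

    colᵛ-∈ : ∀ X Y → Adjᵛ X Y → L La (enc X) (enc Y) (colᵛ X Y)
    colᵛ-∈ hub   (A i) _   = spokeA-∈ i
    colᵛ-∈ hub   (B j) _   = spokeB-∈ j
    colᵛ-∈ (A i) hub   _   = LSym La (enc-adj {hub} {A i} tt) (spokeA-∈ i)
    colᵛ-∈ (B j) hub   _   = LSym La (enc-adj {hub} {B j} tt) (spokeB-∈ j)
    colᵛ-∈ (A i) (A k) i≢k = choice-∈ cliqueA i≢k
    colᵛ-∈ (B j) (B l) j≢l = choice-∈ cliqueB j≢l

    colouring : Colouring G
    colouring = record
      { col = λ u v → colᵛ (dec u) (dec v) ; colSym = λ {u} {v} _ → colᵛ-sym (dec u) (dec v) }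

    colouring-∈ : IsLColouring G La colouring
    colouring-∈ u v a = subst₂ (λ u′ v′ → L La u′ v′ (colᵛ (dec u) (dec v))) (enc-dec u) (enc-dec v)
                               (colᵛ-∈ (dec u) (dec v) a)

    col-enc : ∀ X Y → col colouring (enc X) (enc Y) ≡ colᵛ X Y
    col-enc X Y = cong₂ colᵛ (dec-enc X) (dec-enc Y)

    col-enc-≢ : ∀ X Y Z W → colᵛ X Y ≢ colᵛ Z W →
                col colouring (enc X) (enc Y) ≢ col colouring (enc Z) (enc W)
    col-enc-≢ X Y Z W d e = d (trans (sym (col-enc X Y)) (trans e (col-enc Z W)))

    spokes-differ⇒rainbowGeodesic : ∀ i j → spokeA i ≢ spokeB j →
                                    RainbowGeodesic colouring (enc (A i)) (enc (B j))
    spokes-differ⇒rainbowGeodesic i j d =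
      2 , across-via-hub i j , across-via-hub-geodesic i j ,
      length₂-rainbow colouring (across-via-hub i j) (col-enc-≢ (A i) hub hub (B j) d)

  module _ {r} (La : ListAssignment G) (lists : IsRList G (suc r) La) where

    edgeList : ∀ X Y → Adjᵛ X Y → AtLeast G (suc r) (L La (enc X) (enc Y))
    edgeList X Y a = lists (enc X) (enc Y) (enc-adj a)

    firstOn : ∀ X Y → Adjᵛ X Y → Σ ℕ (L La (enc X) (enc Y))
    firstOn X Y a = first {G = G} (edgeList X Y a)

    avoidOn : ∀ X Y → Adjᵛ X Y → (a : Fin r → ℕ) → Σ ℕ λ y → L La (enc X) (enc Y) y × (∀ i → y ≢ a i)
    avoidOn X Y a = avoid {G = G} (edgeList X Y a)

    anyClique : ∀ {K} (side : Fin K → Vertex) → (∀ {i k} → i ≢ k → Adjᵛ (side i) (side k)) →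
                SymmetricChoice λ i k → L La (enc (side i)) (enc (side k))
    anyClique side clique = symmetricChoice (λ {i} {k} i≢k → LSym La (enc-adj {side i} {side k} (clique i≢k)))
                                            (λ {i} {k} i≢k → firstOn (side i) (side k) (clique i≢k))

  src-upper : SRCList G (suc p)
  src-upper La lists =
    colouring , colouring-∈ ,
    stronglyRainbowConnected colouring
      (λ i j → spokes-differ⇒rainbowGeodesic i j (≢-sym (proj₂ (proj₂ (spokeB j)) i)))
    where
    spokeA : ∀ i → Σ ℕ (L La (enc hub) (enc (A i)))
    spokeA i = firstOn La lists hub (A i) tt
    spokeB : ∀ j → Σ ℕ λ y → L La (enc hub) (enc (B j)) y × (∀ i → y ≢ proj₁ (spokeA i))
    spokeB j = avoidOn La lists hub (B j) tt (proj₁ ∘ spokeA)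
    open SpokeColouring La (proj₁ ∘ spokeA) (proj₂ ∘ spokeA) (proj₁ ∘ spokeB) (proj₁ ∘ proj₂ ∘ spokeB)
                          (anyClique La lists A (λ i≢k → i≢k)) (anyClique La lists B (λ j≢l → j≢l))

  rc-lower : Fin p → Fin q → ¬ RCList G 1
  rc-lower i j rc =
    let (c , c≡0 , connects) = rc zeroes (λ _ _ _ → (λ _ → 0) , (λ { {zero} {zero} _ → refl }) , λ _ → refl)
        (k , path , rb)      = connects (enc (A i)) (enc (B j))
    in ℕ.1+n≰n (ℕ.≤-trans (across-length path) (monochromatic-rainbow-≤1 c (λ {x} {y} → c≡0 x y) path rb))
    where
    zeroes : ListAssignment G
    zeroes = record { L = λ _ _ y → y ≡ 0 ; LSym = λ _ y≡0 → y≡0 }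

module _ (p q : ℕ) where
  open HubAndCliques (suc p) q
  open Graph G using (Adj)

  module TwoListColouring (La : ListAssignment G) (lists : IsRList G 2 La) where

    avoiding : ∀ X Y → Adjᵛ X Y → (z : ℕ) → Σ ℕ λ y → L La (enc X) (enc Y) y × y ≢ z
    avoiding X Y a z with avoidOn La lists X Y a (λ _ → z)
    ... | y , y∈ , y≢z = y , y∈ , y≢z zero

    x : ℕ
    x = proj₁ (firstOn La lists hub (A zero) tt)

    cliqueA : SymmetricChoice λ i k y → L La (enc (A i)) (enc (A k)) y × y ≢ x
    cliqueA = symmetricChoice (λ {i} {k} i≢k (y∈ , y≢x) → LSym La (enc-adj {A i} {A k} i≢k) y∈ , y≢x)
                              (λ {i} {k} i≢k → avoiding (A i) (A k) i≢k x)

    rung : Fin p → ℕ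
    rung k = choice cliqueA (suc k) zero

    rung≢x : ∀ k → rung k ≢ x
    rung≢x k = proj₂ (choice-∈ cliqueA {suc k} {zero} λ ())

    spokeA : Fin (suc p) → ℕ
    spokeA zero    = x
    spokeA (suc k) = proj₁ (avoiding hub (A (suc k)) tt (rung k))

    spokeA-∈ : ∀ i → L La (enc hub) (enc (A i)) (spokeA i)
    spokeA-∈ zero    = proj₂ (firstOn La lists hub (A zero) tt)
    spokeA-∈ (suc k) = proj₁ (proj₂ (avoiding hub (A (suc k)) tt (rung k)))

    spokeA≢rung : ∀ k → spokeA (suc k) ≢ rung k
    spokeA≢rung k = proj₂ (proj₂ (avoiding hub (A (suc k)) tt (rung k)))

    spokeB : ∀ j → Σ ℕ λ y → L La (enc hub) (enc (B j)) y × y ≢ x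
    spokeB j = avoiding hub (B j) tt x

    open SpokeColouring La spokeA spokeA-∈ (proj₁ ∘ spokeB) (proj₁ ∘ proj₂ ∘ spokeB)
                       (SymmetricChoice-map proj₁ cliqueA) (anyClique La lists B (λ j≢l → j≢l)) public

    -- If the spokes at Aᵢ and Bⱼ agree, then i ≠ 0 and Aᵢ, A₀, hub, Bⱼ is rainbow.
    connect : ∀ i j → Dec (spokeA i ≡ proj₁ (spokeB j)) → RainbowPath colouring (enc (A i)) (enc (B j))
    connect i j (no d) = rainbowGeodesic⇒rainbowPath {G = G} {c = colouring} (spokes-differ⇒rainbowGeodesic i j d)
    connect zero    j (yes x≡spokeB) = ⊥-elim (proj₂ (proj₂ (spokeB j)) (sym x≡spokeB))
    connect (suc k) j (yes spokes≡) =
      3 , extend a₁ inner fresh , extend-rainbow colouring a₁ inner fresh inner-rainbow new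
      where
      a₁ : Adj (enc (A (suc k))) (enc (A zero))
      a₁ = enc-adj {A (suc k)} {A zero} λ ()
      inner : Path G (enc (A zero)) (enc (B j)) 2
      inner = path₂ {w = enc hub} (enc-adj {A zero} {hub} tt) (enc-adj {hub} {B j} tt) across-≢
      fresh : ∀ t → enc (A (suc k)) ≢ Path.vtx inner t
      fresh zero             = adj⇒≢ {G = G} a₁
      fresh (suc zero)       = adj⇒≢ {G = G} (enc-adj {A (suc k)} {hub} tt)
      fresh (suc (suc zero)) = across-≢
      inner-rainbow : Rainbow G colouring inner
      inner-rainbow = length₂-rainbow colouring inner
                        (col-enc-≢ (A zero) hub hub (B j) (≢-sym (proj₂ (proj₂ (spokeB j)))))
      new : ∀ t → col colouring (enc (A (suc k))) (enc (A zero)) ≢ edgeCol G colouring inner t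
      new zero       = col-enc-≢ (A (suc k)) (A zero) (A zero) hub (rung≢x k)
      new (suc zero) = col-enc-≢ (A (suc k)) (A zero) hub (B j)
                         (λ rung≡spokeB → spokeA≢rung k (trans spokes≡ (sym rung≡spokeB)))

  rc-upper : RCList G 2
  rc-upper La lists =
    colouring , colouring-∈ ,
    rainbowConnected colouring (λ i j → connect i j (spokeA i ℕ.≟ proj₁ (spokeB j)))
    where open TwoListColouring La lists

module _ (p : ℕ) where
  open HubAndCliques p (p ^ p)

  ⟨_,_⟩ : Fin p → Fin p → ℕ
  ⟨ i , t ⟩ = toℕ (combine i t)

  Image : (Fin p → ℕ) → ℕ → Set
  Image f y = Σ (Fin p) λ t → y ≡ f t

  -- The vertex B g is read as a function g : Fin p → Fin p.
  spokeList : Vertex → Fin p → ℕ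
  spokeList hub   = toℕ
  spokeList (A i) = λ t → ⟨ i , t ⟩
  spokeList (B g) = λ i → ⟨ i , finToFun g i ⟩

  spokeList-injective : ∀ X → Injective _≡_ _≡_ (spokeList X)
  spokeList-injective hub   = toℕ-injective
  spokeList-injective (A i) = combine-injectiveʳ i _ i _ ∘ toℕ-injective
  spokeList-injective (B g) = combine-injectiveˡ _ _ _ _ ∘ toℕ-injective

  blockingᵛ : Vertex → Vertex → Fin p → ℕ
  blockingᵛ hub Y   = spokeList Y
  blockingᵛ X   hub = spokeList X
  blockingᵛ _   _   = toℕ

  blockingᵛ-sym : ∀ X Y → blockingᵛ X Y ≡ blockingᵛ Y X
  blockingᵛ-sym hub   hub   = refl
  blockingᵛ-sym hub   (A _) = refl
  blockingᵛ-sym hub   (B _) = refl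
  blockingᵛ-sym (A _) hub   = refl
  blockingᵛ-sym (B _) hub   = refl
  blockingᵛ-sym (A _) (A _) = refl
  blockingᵛ-sym (A _) (B _) = refl
  blockingᵛ-sym (B _) (A _) = refl
  blockingᵛ-sym (B _) (B _) = refl

  blockingᵛ-injective : ∀ X Y → Injective _≡_ _≡_ (blockingᵛ X Y)
  blockingᵛ-injective hub   Y     = spokeList-injective Y
  blockingᵛ-injective (A i) hub   = spokeList-injective (A i)
  blockingᵛ-injective (B g) hub   = spokeList-injective (B g)
  blockingᵛ-injective (A _) (A _) = toℕ-injective
  blockingᵛ-injective (A _) (B _) = toℕ-injective
  blockingᵛ-injective (B _) (A _) = toℕ-injective
  blockingᵛ-injective (B _) (B _) = toℕ-injective

  blocking : ListAssignment G
  blocking = record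
    { L    = λ u v → Image (blockingᵛ (dec u) (dec v))
    ; LSym = λ {u} {v} _ → subst (λ f → Image f _) (blockingᵛ-sym (dec u) (dec v))
    }

  blocking-lists : IsRList G p blocking
  blocking-lists u v _ =
    blockingᵛ (dec u) (dec v) , blockingᵛ-injective (dec u) (dec v) , λ t → t , refl

  src-lower : ¬ SRCList G p
  src-lower src with src blocking blocking-lists
  ... | c , c-∈ , connects = rainbowGeodesic⇒spokes-differ c (connects (enc (A i₀)) (enc (B g))) clash
    where
    spoke-∈ : ∀ X → Adjᵛ hub X → Image (spokeList X) (col c (enc hub) (enc X))
    spoke-∈ X a = subst (λ Y → Image (spokeList Y) (col c (enc hub) (enc X))) (dec-enc X)
                        (c-∈ (enc hub) (enc X) (enc-adj {hub} {X} a))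
    g : Fin (p ^ p)
    g = funToFin λ i → proj₁ (spoke-∈ (A i) tt)
    i₀ : Fin p
    i₀ = proj₁ (spoke-∈ (B g) tt)
    clash : col c (enc hub) (enc (A i₀)) ≡ col c (enc hub) (enc (B g))
    clash = begin
      col c (enc hub) (enc (A i₀))             ≡⟨ proj₂ (spoke-∈ (A i₀) tt) ⟩
      ⟨ i₀ , proj₁ (spoke-∈ (A i₀) tt) ⟩       ≡⟨ cong ⟨ i₀ ,_⟩ (finToFun-funToFin _ i₀) ⟨
      ⟨ i₀ , finToFun g i₀ ⟩                   ≡⟨ proj₂ (spoke-∈ (B g) tt) ⟨
      col c (enc hub) (enc (B g))              ∎
      where open ≡-Reasoning

lemma4p5 : (b : ℕ) → 3 ≤ b →
    Σ Graph λ G → Connected G × rcℓ≡ G 2 × srcℓ≡ G b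
lemma4p5 (suc (suc (suc k))) _ =
  G , RCList⇒Connected (rc-upper (suc k) q) ,
  monotone-isMin RCList-mono (rc-upper (suc k) q) (rc-lower zero (funToFin {p} {p} λ _ → zero)) ,
  monotone-isMin SRCList-mono src-upper (src-lower p)
  where
  p = suc (suc k)
  q = p ^ p
  open HubAndCliques p q
lemma4p5 (suc zero)       (s≤s ())
lemma4p5 (suc (suc zero)) (s≤s (s≤s ()))
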